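{- Let $b,s,k$ be positive integers, let $r=4bs+1$, and set \[ D:=r^k+\left(br^k+s\right)^2. \] Define $c_1,\dots,c_k$ by $c_i=2br^{(i-1)/2}$ for odd $i$ and $c_i=2br^{k-i/2}$ for even $i$ (so the sequence is $2b,\,2br^{k-1},\,2br,\,2br^{k-2},\,2br^2,\,2br^{k-3},\dots$, of length $k$). Then $l(D)=2k+1$ and \[ \sqrt D=[br^k+s;\overline{c_1,c_2,\dots,c_k,\,c_k,\dots,c_2,c_1,\,2(br^k+s)}]. \]
   Context: For a positive non-square integer $D$, $l(D)$ denotes the length of the fundamental (shortest) period of the regular continued fraction expansion of $\sqrt D$. $[a_0;\overline{b_1,\dots,b_m}]$ denotes the regular continued fraction whose partial quotients after $a_0$ are the block $b_1,\dots,b_m$ repeated infinitely often. -}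

module Defs where

open import Data.Nat as ℕ using (ℕ; zero; suc; _≤ᵇ_)
import Data.Nat.DivMod as ℕD
open import Data.Integer as ℤ using (ℤ; +_; -[1+_]; _+_; _-_; _*_; _/_)
open import Data.Bool using (if_then_else_)
open import Data.Product using (_×_; _,_; proj₁; proj₂)

isqrt : ℕ → ℕ
isqrt zero = zero
isqrt (suc n) with isqrt n
... | m = if (suc m ℕ.* suc m) ≤ᵇ suc n then suc m else m

-- floor division on ℤ, with a (never used) default 0 for divisor 0
_÷_ : ℤ → ℤ → ℤ
x ÷ (+ zero)    = + zero
x ÷ (+ suc n)   = x / (+ suc n)
x ÷ (-[1+ n ])  = x / (-[1+ n ])

-- Regular continued fraction of √D, via the exact complete quotients
--   x_n = (P_n + √D) / Q_n ,  P_0 = 0, Q_0 = 1,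
--   a_n = ⌊x_n⌋ = ⌊(P_n + ⌊√D⌋) / Q_n⌋  (Q_n > 0),
--   P_{n+1} = a_n Q_n - P_n ,  Q_{n+1} = (D - P_{n+1}^2) / Q_n  (exact division),
-- so that x_{n+1} = 1 / (x_n - a_n).
cfState : ℕ → ℕ → ℤ × ℤ
cfState D zero = (+ 0 , + 1)
cfState D (suc n) with cfState D n
... | (P , Q) =
  let a  = (P + + isqrt D) ÷ Q
      P′ = a * Q - P
  in (P′ , (+ D - P′ * P′) ÷ Q)

cfSqrt : ℕ → ℕ → ℤ
cfSqrt D n = (proj₁ (cfState D n) + + isqrt D) ÷ proj₂ (cfState D n)

IsPeriod : ℕ → ℕ → Set
IsPeriod D m = ∀ n → 1 ℕ.≤ n → cfSqrt D (n ℕ.+ m) ≡ cfSqrt D n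
  where open import Relation.Binary.PropositionalEquality using (_≡_)

cSeq : (k b r i : ℕ) → ℕ
cSeq k b r i =
  if ℕD._%_ i 2 ℕ.≡ᵇ 1
  then 2 ℕ.* b ℕ.* r ℕ.^ ℕD._/_ (i ℕ.∸ 1) 2
  else 2 ℕ.* b ℕ.* r ℕ.^ (k ℕ.∸ ℕD._/_ i 2)

-- the period block c_1,…,c_k,c_k,…,c_1,2(b r^k + s), 0-indexed (j < 2k+1)
block : (k b s r j : ℕ) → ℕ
block k b s r j =
  if suc j ≤ᵇ k then cSeq k b r (suc j)
  else if suc j ≤ᵇ 2 ℕ.* k then cSeq k b r (2 ℕ.* k ℕ.∸ j)
  else 2 ℕ.* (b ℕ.* r ℕ.^ k ℕ.+ s)

{-# OPTIONS --safe #-}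
-- Put R = r^k, A = b R + s and B = b R - s. Then D = A² + R with R ≤ 2A, so ⌊√D⌋ = A, and
-- r = 4bs + 1 is exactly what makes D = B² + r R as well. Hence the complete quotients
-- (P + √D)/Q, recorded as pairs (P, Q), run through
--   (A, r^k) → (B, r) → (A, r^(k-1)) → (B, r²) → ⋯ → (A, r) → (B, r^k) → (A, 1) → (A, r^k):
-- for j + t + 1 = k, from (A, r^(t+1)) we divide 2A = 2b r^j r^(t+1) + 2s with remainder 2s < r,
-- from (B, r^(j+1)) we divide A + B = 2b R exactly, and in both cases P′² + Q′ Q = D by the two
-- expressions for D.
-- The partial quotients read off are 2b r^j and 2b r^(k-1-j) alternately, then 2A. A shorter
-- period m would force a_m = a_(2k+1) = 2A, but every earlier partial quotient is at most 2b R < 2A.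
module Submission where

open import Defs
open import Data.Nat using (ℕ; _+_; _*_; _^_; _≤_; _<_; NonZero)
open import Data.Integer using (+_)
open import Data.Product using (_×_)
open import Relation.Binary.PropositionalEquality using (_≡_)

open import Data.Bool using (Bool; true; false; if_then_else_; T)
open import Data.Integer as ℤ using (ℤ; _⊖_)
import Data.Integer.Properties as ℤ
open import Data.Nat using (zero; suc; z≤n; s≤s; _∸_; _≤ᵇ_; _≤?_; >-nonZero)
open import Data.Nat.DivMod using (_/_; _%_; +-distrib-/; [m+kn]%n≡m%n; m*n%n≡0; m*n/n≡m; m<n⇒m%n≡m; m<n⇒m/n≡0; /-monoˡ-≤)
open import Data.Nat.Properties
open import Data.Nat.Tactic.RingSolver using (solve-∀)
open import Data.Product using (_,_; proj₁; proj₂)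
open import Data.Sum using (inj₁; inj₂)
open import Function using (_∘_)
open import Relation.Binary.PropositionalEquality using (refl; sym; trans; cong; cong₂; subst; subst₂; module ≡-Reasoning)
open import Relation.Nullary using (¬_; yes; no; contradiction)

if-T : ∀ {a} {A : Set a} {c : Bool} {x y : A} → T c → (if c then x else y) ≡ x
if-T {c = true} _ = refl

if-¬T : ∀ {a} {A : Set a} {c : Bool} {x y : A} → ¬ T c → (if c then x else y) ≡ y
if-¬T {c = true}  ¬t = contradiction _ ¬t
if-¬T {c = false} _  = refl

if-elim : ∀ {a p} {A : Set a} (P : A → Set p) {c : Bool} {x y : A} → P x → P y → P (if c then x else y)
if-elim P {true}  px _  = px
if-elim P {false} _  py = py

data EvenOdd : ℕ → Set where
  even : ∀ u → EvenOdd (2 * u)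
  odd  : ∀ u → EvenOdd (suc (2 * u))

evenOdd : ∀ n → EvenOdd n
evenOdd zero = even 0
evenOdd (suc n) with evenOdd n
... | even u = odd u
... | odd u  = subst EvenOdd (*-suc 2 u) (even (suc u))

[2u]%2≡0 : ∀ u → 2 * u % 2 ≡ 0
[2u]%2≡0 u = trans (cong (_% 2) (*-comm 2 u)) (m*n%n≡0 u 2)

[1+2u]%2≡1 : ∀ u → suc (2 * u) % 2 ≡ 1
[1+2u]%2≡1 u = trans (cong (λ m → suc m % 2) (*-comm 2 u)) ([m+kn]%n≡m%n 1 u 2)

[2u]/2≡u : ∀ u → 2 * u / 2 ≡ u
[2u]/2≡u u = trans (cong (_/ 2) (*-comm 2 u)) (m*n/n≡m u 2)

[m*n+o]/n≡m : ∀ m n {o} .{{_ : NonZero n}} → o < n → (m * n + o) / n ≡ m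
[m*n+o]/n≡m m n {o} o<n = begin
  (m * n + o) / n     ≡⟨ +-distrib-/ (m * n) o (subst (_< n) (sym no-carry) o<n) ⟩
  m * n / n + o / n   ≡⟨ cong₂ _+_ (m*n/n≡m m n) (m<n⇒m/n≡0 o<n) ⟩
  m + 0               ≡⟨ +-identityʳ m ⟩
  m                   ∎
  where
  open ≡-Reasoning
  no-carry : m * n % n + o % n ≡ o
  no-carry = cong₂ _+_ (m*n%n≡0 m n) (m<n⇒m%n≡m o<n)

square-<⁻¹ : ∀ {m n} → m * m < n * n → m < n
square-<⁻¹ m²<n² = ≰⇒> (λ n≤m → <⇒≱ m²<n² (*-mono-≤ n≤m n≤m))

isqrt-correct : ∀ n → isqrt n * isqrt n ≤ n × n < suc (isqrt n) * suc (isqrt n)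
isqrt-correct zero = z≤n , s≤s z≤n
isqrt-correct (suc n) with isqrt n | isqrt-correct n
... | m | (m²≤n , n<[1+m]²) with suc m * suc m ≤ᵇ suc n in eq
... | true  = ≤ᵇ⇒≤ _ _ (subst T (sym eq) _) , ≤-<-trans n<[1+m]² (*-mono-< (n<1+n (suc m)) (n<1+n (suc m)))
... | false = m≤n⇒m≤1+n m²≤n , ≰⇒> (λ le → subst T eq (≤⇒≤ᵇ le))

isqrt-unique : ∀ n m → m * m ≤ n → n < suc m * suc m → isqrt n ≡ m
isqrt-unique n m m²≤n n<[1+m]² = ≤-antisym
  (m<1+n⇒m≤n (square-<⁻¹ (≤-<-trans (proj₁ (isqrt-correct n)) n<[1+m]²)))
  (m<1+n⇒m≤n (square-<⁻¹ (≤-<-trans m²≤n (proj₂ (isqrt-correct n)))))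

isqrt-square+ : ∀ a e → e ≤ 2 * a → isqrt (a * a + e) ≡ a
isqrt-square+ a e e≤2a = isqrt-unique (a * a + e) a (m≤m+n (a * a) e) (begin-strict
  a * a + e           <⟨ +-monoʳ-< (a * a) (s≤s e≤2a) ⟩
  a * a + suc (2 * a) ≡⟨ expand a ⟩
  suc a * suc a       ∎)
  where
  open ≤-Reasoning
  expand : ∀ a → a * a + suc (2 * a) ≡ suc a * suc a
  expand = solve-∀

pos-÷ : ∀ m n → (+ m) ÷ (+ suc n) ≡ + (m / suc n)
pos-÷ m n = ℤ.*-identityˡ (+ (m / suc n))

o+n≡m⇒+m-+n≡+o : ∀ {m n o} → o + n ≡ m → + m ℤ.- + n ≡ + o
o+n≡m⇒+m-+n≡+o {m} {n} {o} o+n≡m = begin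
  + m ℤ.- + n    ≡⟨ ℤ.m-n≡m⊖n m n ⟩
  m ⊖ n          ≡⟨ ℤ.⊖-≥ (subst (n ≤_) o+n≡m (m≤n+m n o)) ⟩
  + (m ∸ n)      ≡⟨ cong (λ x → + (x ∸ n)) (sym o+n≡m) ⟩
  + (o + n ∸ n)  ≡⟨ cong +_ (m+n∸n≡m o n) ⟩
  + o            ∎
  where open ≡-Reasoning

cfState-step : ∀ {D n P Q a rem P′ Q′} → cfState D n ≡ (+ P , + Q) →
               P + isqrt D ≡ a * Q + rem → rem < Q → P′ + P ≡ a * Q → P′ * P′ + Q′ * Q ≡ D →
               cfSqrt D n ≡ + a × cfState D (suc n) ≡ (+ P′ , + Q′)
cfState-step {D} {n} {P} {Q@(suc q)} {a} {rem} {P′} {Q′} state quot rem<Q next-P norm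
  rewrite state = a≡ , cong₂ _,_ P′≡ Q′≡
  where
  open ≡-Reasoning
  a′ p′ : ℤ
  a′ = (+ P ℤ.+ + isqrt D) ÷ (+ Q)
  p′ = a′ ℤ.* + Q ℤ.- + P
  a≡ : a′ ≡ + a
  a≡ = begin
    (+ (P + isqrt D)) ÷ (+ Q)  ≡⟨ pos-÷ (P + isqrt D) q ⟩
    + ((P + isqrt D) / Q)      ≡⟨ cong (λ m → + (m / Q)) quot ⟩
    + ((a * Q + rem) / Q)      ≡⟨ cong +_ ([m*n+o]/n≡m a Q rem<Q) ⟩
    + a                        ∎
  P′≡ : p′ ≡ + P′
  P′≡ = begin
    a′ ℤ.* + Q ℤ.- + P   ≡⟨ cong (λ x → x ℤ.* + Q ℤ.- + P) a≡ ⟩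
    + a ℤ.* + Q ℤ.- + P  ≡⟨ cong (ℤ._- + P) (sym (ℤ.pos-* a Q)) ⟩
    + (a * Q) ℤ.- + P    ≡⟨ o+n≡m⇒+m-+n≡+o next-P ⟩
    + P′                 ∎
  Q′Q+P′²≡D : Q′ * Q + P′ * P′ ≡ D
  Q′Q+P′²≡D = trans (+-comm (Q′ * Q) (P′ * P′)) norm
  Q′≡ : (+ D ℤ.- p′ ℤ.* p′) ÷ (+ Q) ≡ + Q′
  Q′≡ = begin
    (+ D ℤ.- p′ ℤ.* p′) ÷ (+ Q)      ≡⟨ cong (λ x → (+ D ℤ.- x ℤ.* x) ÷ (+ Q)) P′≡ ⟩
    (+ D ℤ.- + P′ ℤ.* + P′) ÷ (+ Q)  ≡⟨ cong (λ x → (+ D ℤ.- x) ÷ (+ Q)) (sym (ℤ.pos-* P′ P′)) ⟩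
    (+ D ℤ.- + (P′ * P′)) ÷ (+ Q)    ≡⟨ cong (_÷ (+ Q)) (o+n≡m⇒+m-+n≡+o {n = P′ * P′} Q′Q+P′²≡D) ⟩
    (+ (Q′ * Q)) ÷ (+ Q)             ≡⟨ pos-÷ (Q′ * Q) q ⟩
    + (Q′ * Q / Q)                   ≡⟨ cong +_ (m*n/n≡m Q′ Q) ⟩
    + Q′                             ∎

cfState-suc-cong : ∀ {D m n} → cfState D m ≡ cfState D n → cfState D (suc m) ≡ cfState D (suc n)
cfState-suc-cong e rewrite e = refl

cfSqrt-cong : ∀ {D m n} → cfState D m ≡ cfState D n → cfSqrt D m ≡ cfSqrt D n
cfSqrt-cong e rewrite e = refl

cfState-recurrence⇒IsPeriod : ∀ {D m} → cfState D (suc m) ≡ cfState D 1 → IsPeriod D m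
cfState-recurrence⇒IsPeriod {D} {m} recur (suc n) _ = cfSqrt-cong {D} {suc n + m} {suc n} (shift n)
  where
  shift : ∀ n → cfState D (suc n + m) ≡ cfState D (suc n)
  shift zero    = recur
  shift (suc n) = cfState-suc-cong {D} {suc n + m} {suc n} (shift n)

IsPeriod-minimal : ∀ {D L} → IsPeriod D L → (∀ i → 1 ≤ i → i < L → cfSqrt D i ℤ.< cfSqrt D L) →
                   ∀ m → 1 ≤ m → IsPeriod D m → L ≤ m
IsPeriod-minimal {D} {L} period-L below m 1≤m period-m with L ≤? m
... | yes L≤m = L≤m
... | no  L≰m = contradiction same-quotient (ℤ.<⇒≢ (below m 1≤m m<L))
  where
  open ≡-Reasoning
  m<L = ≰⇒> L≰m
  same-quotient : cfSqrt D m ≡ cfSqrt D L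
  same-quotient = begin
    cfSqrt D m         ≡⟨ sym (period-L m 1≤m) ⟩
    cfSqrt D (m + L)   ≡⟨ cong (cfSqrt D) (+-comm m L) ⟩
    cfSqrt D (L + m)   ≡⟨ period-m L (≤-trans 1≤m (<⇒≤ m<L)) ⟩
    cfSqrt D L         ∎

cSeq-odd : ∀ k b r u → cSeq k b r (suc (2 * u)) ≡ 2 * b * r ^ u
cSeq-odd k b r u rewrite [1+2u]%2≡1 u = cong (λ e → 2 * b * r ^ e) ([2u]/2≡u u)

cSeq-even : ∀ k b r u → cSeq k b r (2 * u) ≡ 2 * b * r ^ (k ∸ u)
cSeq-even k b r u rewrite [2u]%2≡0 u = cong (λ e → 2 * b * r ^ (k ∸ e)) ([2u]/2≡u u)

cSeq≤ : ∀ k b r i .{{_ : NonZero r}} → i ≤ 2 * k → cSeq k b r i ≤ 2 * b * r ^ k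
cSeq≤ k b r i i≤2k = if-elim (_≤ 2 * b * r ^ k)
  (*-monoʳ-≤ (2 * b) (^-monoʳ-≤ r [i∸1]/2≤k))
  (*-monoʳ-≤ (2 * b) (^-monoʳ-≤ r (m∸n≤m k (i / 2))))
  where
  [i∸1]/2≤k : (i ∸ 1) / 2 ≤ k
  [i∸1]/2≤k = ≤-trans (/-monoˡ-≤ 2 (≤-trans (m∸n≤m i 1) i≤2k)) (≤-reflexive ([2u]/2≡u k))

cSeq-reflect : ∀ k b r j → j < 2 * k → cSeq k b r (2 * k ∸ j) ≡ cSeq k b r (suc j)
cSeq-reflect k b r j j<2k with evenOdd j
... | even u = begin
  cSeq k b r (2 * k ∸ 2 * u)   ≡⟨ cong (cSeq k b r) (sym (*-distribˡ-∸ 2 k u)) ⟩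
  cSeq k b r (2 * (k ∸ u))     ≡⟨ cSeq-even k b r (k ∸ u) ⟩
  2 * b * r ^ (k ∸ (k ∸ u))    ≡⟨ cong (λ e → 2 * b * r ^ e) (m∸[m∸n]≡n (<⇒≤ (*-cancelˡ-< 2 u k j<2k))) ⟩
  2 * b * r ^ u                ≡⟨ sym (cSeq-odd k b r u) ⟩
  cSeq k b r (suc (2 * u))     ∎
  where open ≡-Reasoning
... | odd u = begin
  cSeq k b r (2 * k ∸ suc (2 * u))  ≡⟨ cong (cSeq k b r) 2k∸j≡1+2t ⟩
  cSeq k b r (suc (2 * t))          ≡⟨ cSeq-odd k b r t ⟩
  2 * b * r ^ t                     ≡⟨ sym (cSeq-even k b r (suc u)) ⟩
  cSeq k b r (2 * suc u)            ≡⟨ cong (cSeq k b r) (*-suc 2 u) ⟩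
  cSeq k b r (suc (suc (2 * u)))    ∎
  where
  open ≡-Reasoning
  t = k ∸ suc u
  1+u+t≡k : suc u + t ≡ k
  1+u+t≡k = m+[n∸m]≡n {suc u} (*-cancelˡ-≤ {suc u} 2 (subst (_≤ 2 * k) (sym (*-suc 2 u)) j<2k))
  double : ∀ u t → 2 * (suc u + t) ≡ suc (2 * u) + suc (2 * t)
  double = solve-∀
  2k∸j≡1+2t : 2 * k ∸ suc (2 * u) ≡ suc (2 * t)
  2k∸j≡1+2t = begin
    2 * k ∸ suc (2 * u)                   ≡⟨ cong (λ k → 2 * k ∸ suc (2 * u)) (sym 1+u+t≡k) ⟩
    2 * (suc u + t) ∸ suc (2 * u)         ≡⟨ cong (_∸ suc (2 * u)) (double u t) ⟩
    suc (2 * u) + suc (2 * t) ∸ suc (2 * u) ≡⟨ m+n∸m≡n (suc (2 * u)) (suc (2 * t)) ⟩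
    suc (2 * t)                           ∎

block≡cSeq : ∀ k b s r j → j < 2 * k → block k b s r j ≡ cSeq k b r (suc j)
block≡cSeq k b s r j j<2k with suc j ≤? k
... | yes j<k = if-T (≤⇒≤ᵇ j<k)
... | no  j≮k = trans (if-¬T (j≮k ∘ ≤ᵇ⇒≤ (suc j) k)) (trans (if-T (≤⇒≤ᵇ j<2k)) (cSeq-reflect k b r j j<2k))

block-last : ∀ k b s r → block k b s r (2 * k) ≡ 2 * (b * r ^ k + s)
block-last k b s r = trans (if-¬T (≤⇒≯ (m≤m+n k (k + 0)) ∘ ≤ᵇ⇒≤ (suc (2 * k)) k))
                           (if-¬T (n≮n (2 * k) ∘ ≤ᵇ⇒≤ (suc (2 * k)) (2 * k)))

module Expansion (b s k : ℕ) (1≤b : 1 ≤ b) (1≤s : 1 ≤ s) (1≤k : 1 ≤ k) where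

  r R A B D : ℕ
  r = 4 * b * s + 1
  R = r ^ k
  A = b * R + s
  B = b * R ∸ s
  D = R + A ^ 2

  instance
    r≢0 : NonZero r
    r≢0 = >-nonZero (m≤n+m 1 (4 * b * s))
    b≢0 : NonZero b
    b≢0 = >-nonZero 1≤b

  2s<r : 2 * s < r
  2s<r = ≤-<-trans (*-monoˡ-≤ s (≤-trans (s≤s (s≤s z≤n)) (*-monoʳ-≤ 4 1≤b))) (m<m+n (4 * b * s) (s≤s z≤n))

  r≤r^[1+t] : ∀ t → r ≤ r ^ suc t
  r≤r^[1+t] t = m≤m*n r (r ^ t) {{m^n≢0 r t}}

  s≤bR : s ≤ b * R
  s≤bR = begin
    s      ≤⟨ m≤m+n s (s + 0) ⟩
    2 * s  ≤⟨ <⇒≤ 2s<r ⟩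
    r      ≡⟨ *-identityʳ r ⟨
    r ^ 1  ≤⟨ ^-monoʳ-≤ r 1≤k ⟩
    R      ≤⟨ m≤n*m R b ⟩
    b * R  ∎
    where open ≤-Reasoning

  B+s≡bR : B + s ≡ b * R
  B+s≡bR = m∸n+n≡m s≤bR

  A+B≡2bR : A + B ≡ 2 * b * R
  A+B≡2bR = begin
    (b * R + s) + B  ≡⟨ regroup (b * R) s B ⟩
    b * R + (B + s)  ≡⟨ cong (_+_ (b * R)) B+s≡bR ⟩
    b * R + b * R    ≡⟨ twice b R ⟩
    2 * b * R        ∎
    where
    open ≡-Reasoning
    regroup : ∀ x s B → (x + s) + B ≡ x + (B + s)
    regroup = solve-∀
    twice : ∀ b R → b * R + b * R ≡ 2 * b * R
    twice = solve-∀

  D≡A²+R : D ≡ A * A + R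
  D≡A²+R = expand R A
    where
    expand : ∀ R A → R + A * (A * 1) ≡ A * A + R
    expand = solve-∀

  B²+rR≡D : B * B + r * R ≡ D
  B²+rR≡D = begin
    B * B + r * R                  ≡⟨ unfold-r B b s R ⟩
    B * B + R + 4 * s * (b * R)    ≡⟨ cong (λ x → B * B + R + 4 * s * x) B+s≡bR ⟨
    B * B + R + 4 * s * (B + s)    ≡⟨ complete-square B s R ⟩
    (B + s + s) * (B + s + s) + R  ≡⟨ cong (λ x → (x + s) * (x + s) + R) B+s≡bR ⟩
    A * A + R                      ≡⟨ D≡A²+R ⟨
    D                              ∎
    where
    open ≡-Reasoning
    unfold-r : ∀ B b s R → B * B + (4 * b * s + 1) * R ≡ B * B + R + 4 * s * (b * R)
    unfold-r = solve-∀
    complete-square : ∀ B s R → B * B + R + 4 * s * (B + s) ≡ (B + s + s) * (B + s + s) + R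
    complete-square = solve-∀

  isqrt-D : isqrt D ≡ A
  isqrt-D = trans (cong isqrt D≡A²+R) (isqrt-square+ A R R≤2A)
    where
    R≤2A : R ≤ 2 * A
    R≤2A = ≤-trans (m≤n*m R b) (≤-trans (m≤m+n (b * R) s) (m≤m+n A (A + 0)))

  R-split : ∀ i j → i + j ≡ k → R ≡ r ^ i * r ^ j
  R-split i j i+j≡k = trans (cong (r ^_) (sym i+j≡k)) (^-distribˡ-+-* r i j)

  2bR-split : ∀ i j → i + j ≡ k → 2 * b * R ≡ 2 * b * r ^ i * r ^ j
  2bR-split i j i+j≡k = trans (cong (_*_ (2 * b)) (R-split i j i+j≡k)) (sym (*-assoc (2 * b) (r ^ i) (r ^ j)))

  first-step : cfSqrt D 0 ≡ + A × cfState D 1 ≡ (+ A , + R)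
  first-step = cfState-step {n = 0} refl (trans isqrt-D (sym A*1+0≡A)) (s≤s z≤n)
                 (trans (+-identityʳ A) (sym (*-identityʳ A)))
                 (trans (cong (_+_ (A * A)) (*-identityʳ R)) (sym D≡A²+R))
    where
    A*1+0≡A : A * 1 + 0 ≡ A
    A*1+0≡A = trans (+-identityʳ (A * 1)) (*-identityʳ A)

  odd-step : ∀ n j t → j + suc t ≡ k → cfState D n ≡ (+ A , + r ^ suc t) →
             cfSqrt D n ≡ + (2 * b * r ^ j) × cfState D (suc n) ≡ (+ B , + r ^ suc j)
  odd-step n j t j+1+t≡k state = cfState-step state quot (<-≤-trans 2s<r (r≤r^[1+t] t))
    (trans (+-comm B A) (trans A+B≡2bR (2bR-split j (suc t) j+1+t≡k))) norm
    where
    open ≡-Reasoning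
    A+A : ∀ b R s → (b * R + s) + (b * R + s) ≡ 2 * b * R + 2 * s
    A+A = solve-∀
    quot : A + isqrt D ≡ 2 * b * r ^ j * r ^ suc t + 2 * s
    quot = begin
      A + isqrt D                        ≡⟨ cong (_+_ A) isqrt-D ⟩
      A + A                              ≡⟨ A+A b R s ⟩
      2 * b * R + 2 * s                  ≡⟨ cong (_+ 2 * s) (2bR-split j (suc t) j+1+t≡k) ⟩
      2 * b * r ^ j * r ^ suc t + 2 * s  ∎
    norm : B * B + r ^ suc j * r ^ suc t ≡ D
    norm = begin
      B * B + r * r ^ j * r ^ suc t      ≡⟨ cong (_+_ (B * B)) (*-assoc r (r ^ j) (r ^ suc t)) ⟩
      B * B + r * (r ^ j * r ^ suc t)    ≡⟨ cong (λ x → B * B + r * x) (R-split j (suc t) j+1+t≡k) ⟨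
      B * B + r * R                      ≡⟨ B²+rR≡D ⟩
      D                                  ∎

  even-step : ∀ n j t → j + suc t ≡ k → cfState D n ≡ (+ B , + r ^ suc j) →
              cfSqrt D n ≡ + (2 * b * r ^ t) × cfState D (suc n) ≡ (+ A , + r ^ t)
  even-step n j t j+1+t≡k state = cfState-step state quot (m^n>0 r (suc j)) A+B≡2br^tr^[1+j] norm
    where
    t+1+j≡k : t + suc j ≡ k
    t+1+j≡k = trans (+-comm t (suc j)) (trans (sym (+-suc j t)) j+1+t≡k)
    A+B≡2br^tr^[1+j] : A + B ≡ 2 * b * r ^ t * r ^ suc j
    A+B≡2br^tr^[1+j] = trans A+B≡2bR (2bR-split t (suc j) t+1+j≡k)
    quot : B + isqrt D ≡ 2 * b * r ^ t * r ^ suc j + 0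
    quot = trans (cong (_+_ B) isqrt-D) (trans (+-comm B A) (trans A+B≡2br^tr^[1+j] (sym (+-identityʳ _))))
    norm : A * A + r ^ t * r ^ suc j ≡ D
    norm = trans (cong (_+_ (A * A)) (sym (R-split t (suc j) t+1+j≡k))) (sym D≡A²+R)

  cfState-odd  : ∀ j t → j + t ≡ k → cfState D (suc (2 * j)) ≡ (+ A , + r ^ t)
  cfState-even : ∀ j t → j + suc t ≡ k → cfState D (suc (suc (2 * j))) ≡ (+ B , + r ^ suc j)

  cfState-odd zero t t≡k = subst (λ e → cfState D 1 ≡ (+ A , + r ^ e)) (sym t≡k) (proj₂ first-step)
  cfState-odd (suc j) t 1+j+t≡k =
    trans (cong (cfState D ∘ suc) (*-suc 2 j))
          (proj₂ (even-step (suc (suc (2 * j))) j t j+1+t≡k (cfState-even j t j+1+t≡k)))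
    where
    j+1+t≡k : j + suc t ≡ k
    j+1+t≡k = trans (+-suc j t) 1+j+t≡k

  cfState-even j t j+1+t≡k = proj₂ (odd-step (suc (2 * j)) j t j+1+t≡k (cfState-odd j (suc t) j+1+t≡k))

  j+1+[k∸1+j]≡k : ∀ {j} → j < k → j + suc (k ∸ suc j) ≡ k
  j+1+[k∸1+j]≡k {j} j<k = trans (+-suc j (k ∸ suc j)) (m+[n∸m]≡n j<k)

  cfSqrt-odd : ∀ j → j < k → cfSqrt D (suc (2 * j)) ≡ + (2 * b * r ^ j)
  cfSqrt-odd j j<k = proj₁ (odd-step (suc (2 * j)) j t split (cfState-odd j (suc t) split))
    where
    t = k ∸ suc j
    split : j + suc t ≡ k
    split = j+1+[k∸1+j]≡k j<k

  cfSqrt-even : ∀ j → j < k → cfSqrt D (suc (suc (2 * j))) ≡ + (2 * b * r ^ (k ∸ suc j))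
  cfSqrt-even j j<k = proj₁ (even-step (suc (suc (2 * j))) j t split (cfState-even j t split))
    where
    t = k ∸ suc j
    split : j + suc t ≡ k
    split = j+1+[k∸1+j]≡k j<k

  closing-step : cfSqrt D (suc (2 * k)) ≡ + (2 * A) × cfState D (suc (suc (2 * k))) ≡ (+ A , + R)
  closing-step = cfState-step {n = suc (2 * k)} (cfState-odd k 0 (+-identityʳ k))
                   (trans (cong (_+_ A) isqrt-D) (A+A A)) (s≤s z≤n) (trans (A+A A) (+-identityʳ _))
                   (trans (cong (_+_ (A * A)) (*-identityʳ R)) (sym D≡A²+R))
    where
    A+A : ∀ A → A + A ≡ 2 * A * 1 + 0
    A+A = solve-∀

  cfSqrt-2k+1 : cfSqrt D (2 * k + 1) ≡ + (2 * A)
  cfSqrt-2k+1 = trans (cong (cfSqrt D) (+-comm (2 * k) 1)) (proj₁ closing-step)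

  cfSqrt≡cSeq : ∀ i → 1 ≤ i → i ≤ 2 * k → cfSqrt D i ≡ + cSeq k b r i
  cfSqrt≡cSeq i 1≤i i≤2k with evenOdd i
  cfSqrt≡cSeq _ () _ | even zero
  ... | even (suc j) = begin
    cfSqrt D (2 * suc j)               ≡⟨ cong (cfSqrt D) (*-suc 2 j) ⟩
    cfSqrt D (suc (suc (2 * j)))       ≡⟨ cfSqrt-even j (*-cancelˡ-≤ {suc j} 2 i≤2k) ⟩
    + (2 * b * r ^ (k ∸ suc j))        ≡⟨ cong +_ (cSeq-even k b r (suc j)) ⟨
    + cSeq k b r (2 * suc j)           ∎
    where open ≡-Reasoning
  ... | odd j = trans (cfSqrt-odd j (*-cancelˡ-< 2 j k i≤2k)) (cong +_ (sym (cSeq-odd k b r j)))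

  cfSqrt-block : ∀ j → j < 2 * k + 1 → cfSqrt D (1 + j) ≡ + block k b s r j
  cfSqrt-block j j<2k+1 with m<1+n⇒m<n∨m≡n (subst (j <_) (+-comm (2 * k) 1) j<2k+1)
  ... | inj₁ j<2k = trans (cfSqrt≡cSeq (suc j) (s≤s z≤n) j<2k) (cong +_ (sym (block≡cSeq k b s r j j<2k)))
  ... | inj₂ refl = trans (proj₁ closing-step) (cong +_ (sym (block-last k b s r)))

  period : IsPeriod D (2 * k + 1)
  period = cfState-recurrence⇒IsPeriod (begin
    cfState D (suc (2 * k + 1))    ≡⟨ cong (cfState D ∘ suc) (+-comm (2 * k) 1) ⟩
    cfState D (suc (suc (2 * k)))  ≡⟨ proj₂ closing-step ⟩
    (+ A , + R)                    ≡⟨ proj₂ first-step ⟨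
    cfState D 1                    ∎)
    where open ≡-Reasoning

  cfSqrt<cfSqrt-2k+1 : ∀ i → 1 ≤ i → i < 2 * k + 1 → cfSqrt D i ℤ.< cfSqrt D (2 * k + 1)
  cfSqrt<cfSqrt-2k+1 i 1≤i i<2k+1 =
    subst₂ ℤ._<_ (sym (cfSqrt≡cSeq i 1≤i i≤2k)) (sym cfSqrt-2k+1) (ℤ.+<+ (begin-strict
    cSeq k b r i       ≤⟨ cSeq≤ k b r i i≤2k ⟩
    2 * b * R          ≡⟨ *-assoc 2 b R ⟩
    2 * (b * R)        <⟨ *-monoʳ-< 2 (m<m+n (b * R) 1≤s) ⟩
    2 * A              ∎))
    where
    open ≤-Reasoning
    i≤2k : i ≤ 2 * k
    i≤2k = m<1+n⇒m≤n (subst (i <_) (+-comm (2 * k) 1) i<2k+1)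

theorem6 : (b s k : ℕ) → 1 ≤ b → 1 ≤ s → 1 ≤ k →
    let r = 4 * b * s + 1
        D = r ^ k + (b * r ^ k + s) ^ 2
    in (cfSqrt D 0 ≡ + (b * r ^ k + s))
       × ((j : ℕ) → j < 2 * k + 1 → cfSqrt D (1 + j) ≡ + block k b s r j)
       × IsPeriod D (2 * k + 1)
       × ((m : ℕ) → 1 ≤ m → IsPeriod D m → 2 * k + 1 ≤ m)
theorem6 b s k 1≤b 1≤s 1≤k =
  proj₁ first-step , cfSqrt-block , period , IsPeriod-minimal period cfSqrt<cfSqrt-2k+1
  where open Expansion b s k 1≤b 1≤s 1≤k
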